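{- Let $G$ be a graph. The line graph of $G$ is fully regular if and only if every edge of $G$ is adjacent to the same number of other edges and every pair of independent edges of $G$ is connected by the same number of edges.
   Context: Two distinct edges are adjacent if they share a vertex, independent otherwise; an edge connects two independent edges if it shares a vertex with each. The line graph $L(G)$ has the edges of $G$ as vertices, adjacent iff they are adjacent edges. A graph $H$ is fully regular if there are numbers $a_0,\dots,a_{\alpha(H)}$ such that for every independent set $I\subseteq V(H)$, the number of vertices in $V(H)\setminus I$ not adjacent to any element of $I$ equals $a_{|I|}$. -}

module Defs where

open import Data.Nat using (ℕ; _<ᵇ_)
open import Data.Bool using (Bool; true; false; not; _∧_; _∨_)
open import Data.Fin using (Fin; toℕ; _≟_)
open import Data.List using (List; length; filterᵇ; map; concatMap; lookup)
open import Data.Bool.ListAction using (any)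
open import Data.List using () renaming (allFin to allFinL)
open import Data.Product using (_×_; _,_; Σ)
open import Relation.Nullary using (¬_)
open import Relation.Nullary.Decidable using (⌊_⌋)
open import Relation.Binary.PropositionalEquality using (_≡_)

record Graph : Set where
  field
    n      : ℕ
    adj    : Fin n → Fin n → Bool
    sym    : ∀ i j → adj i j ≡ adj j i
    irrefl : ∀ i → adj i i ≡ false
open Graph public

_=ᶠ_ : ∀ {k} → Fin k → Fin k → Bool
a =ᶠ b = ⌊ a ≟ b ⌋

count : ∀ {k} → (Fin k → Bool) → ℕ
count {k} p = length (filterᵇ p (allFinL k))

someᵇ : ∀ {k} → (Fin k → Bool) → Bool
someᵇ {k} p = any p (allFinL k)

-- Edges of G: each edge {i,j} listed exactly once as the pair (i , j)
-- with i < j and i ~ j.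

allPairs : (k : ℕ) → List (Fin k × Fin k)
allPairs k = concatMap (λ i → map (λ j → (i , j)) (allFinL k)) (allFinL k)

edgeList : (G : Graph) → List (Fin (n G) × Fin (n G))
edgeList G = filterᵇ (λ { (i , j) → (toℕ i <ᵇ toℕ j) ∧ adj G i j }) (allPairs (n G))

#E : Graph → ℕ
#E G = length (edgeList G)

Edge : Graph → Set
Edge G = Fin (#E G)

ends : (G : Graph) → Edge G → Fin (n G) × Fin (n G)
ends G e = lookup (edgeList G) e

shareVertex : ∀ {k} → Fin k × Fin k → Fin k × Fin k → Bool
shareVertex (a , b) (c , d) = (a =ᶠ c) ∨ (a =ᶠ d) ∨ (b =ᶠ c) ∨ (b =ᶠ d)

edgeAdj : (G : Graph) → Edge G → Edge G → Bool
edgeAdj G e f = not (e =ᶠ f) ∧ shareVertex (ends G e) (ends G f)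

EdgeIndependent : (G : Graph) → Edge G → Edge G → Set
EdgeIndependent G e f = (¬ e ≡ f) × (shareVertex (ends G e) (ends G f) ≡ false)

record FinGraph : Set where
  field
    size  : ℕ
    adjH  : Fin size → Fin size → Bool
open FinGraph public

LineGraph : Graph → FinGraph
LineGraph G = record { size = #E G ; adjH = edgeAdj G }

IndependentSet : (H : FinGraph) → (Fin (size H) → Bool) → Set
IndependentSet H I = ∀ u v → I u ≡ true → I v ≡ true → adjH H u v ≡ false

nonNbrs : (H : FinGraph) → (Fin (size H) → Bool) → ℕ
nonNbrs H I = count (λ v → not (I v) ∧ not (someᵇ (λ u → I u ∧ adjH H u v)))

-- H fully regular: a_{|I|} depends only on |I| for independent sets I
-- (a sequence a : ℕ → ℕ; only values at 0..α(H) are ever constrained)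
FullyRegular : FinGraph → Set
FullyRegular H = Σ (ℕ → ℕ) λ a →
  ∀ (I : Fin (size H) → Bool) → IndependentSet H I → nonNbrs H I ≡ a (count I)

EdgeRegular : Graph → Set
EdgeRegular G = Σ ℕ λ k → ∀ (e : Edge G) → count (edgeAdj G e) ≡ k

IndepPairsRegular : Graph → Set
IndepPairsRegular G = Σ ℕ λ c → ∀ (e f : Edge G) → EdgeIndependent G e f →
  count (λ g → edgeAdj G g e ∧ edgeAdj G g f) ≡ c

-- In L(G) an independent set is a matching, and an edge, having only two ends, meets at most two
-- edges of a matching: L(G) is claw-free. In a claw-free graph the neighbourhoods of the m vertices
-- of an independent set I overlap only pairwise, so if every vertex has degree k and any two
-- nonadjacent vertices have c common neighbours, inclusion–exclusion gives |N(I)| = m k − C(m,2) c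
-- and the number of vertices outside I ∪ N(I) depends on m alone. Conversely, independent sets of
-- sizes one and two recover k and c from a₁ and a₂.

module Submission where

open import Defs hiding (sym; adj)
open import Data.Bool using (Bool; true; false; not; _∧_; _∨_)
open import Data.Bool.Properties using (∨-zeroʳ; ∧-zeroʳ; ∧-identityʳ; ∧-distribˡ-∨; ¬-not; T-≡)
open import Data.Bool.ListAction using (or)
open import Data.Empty using (⊥)
open import Data.Fin using (Fin; zero; suc; _≟_)
open import Data.List using (length; filterᵇ; map; allFin; tabulate; []; _∷_)
open import Data.List.Properties using (length-tabulate; map-tabulate; map-cong)
open import Data.List.Membership.Propositional using (lose)
open import Data.List.Membership.Propositional.Properties using (∈-allFin)
open import Data.List.Relation.Unary.Any using (satisfied)
open import Data.List.Relation.Unary.Any.Properties using (any⁺; any⁻)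
open import Data.Nat using (ℕ; zero; suc; _+_; _*_; _∸_)
open import Data.Nat.Combinatorics using (_C_; nC1≡n; nCk+nC[k+1]≡[n+1]C[k+1])
open import Data.Nat.Properties
  using (+-suc; +-identityʳ; +-comm; +-assoc; *-distribʳ-+; suc-injective; m+n∸n≡m; m+n∸m≡n)
open import Data.Product using (Σ; ∃; _×_; _,_; proj₁; proj₂; map₂)
open import Data.Sum using (_⊎_; inj₁; inj₂)
open import Function using (_∘_; id; case_of_)
open import Function.Bundles using (module Equivalence)
open import Relation.Nullary using (¬_; yes; no)
open import Relation.Nullary.Decidable using (toWitness; dec-true; dec-false; isYes≗does; ⌊⌋-map′)
open import Relation.Binary.PropositionalEquality

∧-true : ∀ {a b} → a ∧ b ≡ true → a ≡ true × b ≡ true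
∧-true {true} {true} _ = refl , refl

∨-true : ∀ {a b} → a ∨ b ≡ true → a ≡ true ⊎ b ≡ true
∨-true {true}  _ = inj₁ refl
∨-true {false} h = inj₂ h

∧-intro : ∀ {a b} → a ≡ true → b ≡ true → a ∧ b ≡ true
∧-intro refl refl = refl

∨-introˡ : ∀ {a} b → a ≡ true → a ∨ b ≡ true
∨-introˡ b refl = refl

∨-introʳ : ∀ a {b} → b ≡ true → a ∨ b ≡ true
∨-introʳ a refl = ∨-zeroʳ a

Bool-ext : ∀ {a b} → (a ≡ true → b ≡ true) → (b ≡ true → a ≡ true) → a ≡ b
Bool-ext {true}  {true}  _ _ = refl
Bool-ext {true}  {false} f _ = sym (f refl)
Bool-ext {false} {true}  _ g = g refl
Bool-ext {false} {false} _ _ = refl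

module _ {k : ℕ} {a b : Fin k} where

  ≡⇒=ᶠ : a ≡ b → (a =ᶠ b) ≡ true
  ≡⇒=ᶠ a≡b = trans (isYes≗does (a ≟ b)) (dec-true (a ≟ b) a≡b)

  ≢⇒=ᶠ : ¬ a ≡ b → (a =ᶠ b) ≡ false
  ≢⇒=ᶠ a≢b = trans (isYes≗does (a ≟ b)) (dec-false (a ≟ b) a≢b)

  =ᶠ⇒≡ : (a =ᶠ b) ≡ true → a ≡ b
  =ᶠ⇒≡ h = toWitness (Equivalence.from T-≡ h)

=ᶠ-sym : ∀ {k} (a b : Fin k) → (a =ᶠ b) ≡ (b =ᶠ a)
=ᶠ-sym a b = Bool-ext (≡⇒=ᶠ ∘ sym ∘ =ᶠ⇒≡) (≡⇒=ᶠ ∘ sym ∘ =ᶠ⇒≡)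

=ᶠ-suc : ∀ {k} (a b : Fin k) → (suc a =ᶠ suc b) ≡ (a =ᶠ b)
=ᶠ-suc a b = ⌊⌋-map′ _ _ (a ≟ b)

module _ {A : Set} where

  length-filterᵇ-cong : ∀ {p q : A → Bool} → (∀ x → p x ≡ q x) →
    ∀ xs → length (filterᵇ p xs) ≡ length (filterᵇ q xs)
  length-filterᵇ-cong p≗q [] = refl
  length-filterᵇ-cong {q = q} p≗q (x ∷ xs) rewrite p≗q x with q x
  ... | true  = cong suc (length-filterᵇ-cong p≗q xs)
  ... | false = length-filterᵇ-cong p≗q xs

  length-filterᵇ-none : ∀ {p : A → Bool} → (∀ x → p x ≡ false) →
    ∀ xs → length (filterᵇ p xs) ≡ 0
  length-filterᵇ-none none [] = refl
  length-filterᵇ-none none (x ∷ xs) rewrite none x = length-filterᵇ-none none xs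

  length-filterᵇ-∨-∧ : ∀ (p q : A → Bool) xs →
    length (filterᵇ (λ x → p x ∨ q x) xs) + length (filterᵇ (λ x → p x ∧ q x) xs)
      ≡ length (filterᵇ p xs) + length (filterᵇ q xs)
  length-filterᵇ-∨-∧ p q [] = refl
  length-filterᵇ-∨-∧ p q (x ∷ xs) with p x | q x | length-filterᵇ-∨-∧ p q xs
  ... | true  | true  | ih = cong suc (trans (+-suc _ _) (trans (cong suc ih) (sym (+-suc _ _))))
  ... | true  | false | ih = cong suc ih
  ... | false | true  | ih = trans (cong suc ih) (sym (+-suc _ _))
  ... | false | false | ih = ih

  length-filterᵇ-not : ∀ (p : A → Bool) xs →
    length (filterᵇ p xs) + length (filterᵇ (not ∘ p) xs) ≡ length xs
  length-filterᵇ-not p [] = refl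
  length-filterᵇ-not p (x ∷ xs) with p x
  ... | true  = cong suc (length-filterᵇ-not p xs)
  ... | false = trans (+-suc _ _) (cong suc (length-filterᵇ-not p xs))

  length-filterᵇ-map : ∀ {B : Set} (p : B → Bool) (f : A → B) xs →
    length (filterᵇ p (map f xs)) ≡ length (filterᵇ (p ∘ f) xs)
  length-filterᵇ-map p f [] = refl
  length-filterᵇ-map p f (x ∷ xs) with p (f x)
  ... | true  = cong suc (length-filterᵇ-map p f xs)
  ... | false = length-filterᵇ-map p f xs

  length-filterᵇ-satisfied : ∀ (p : A → Bool) xs {m} →
    length (filterᵇ p xs) ≡ suc m → ∃ λ x → p x ≡ true
  length-filterᵇ-satisfied p (x ∷ xs) h with p x in px
  ... | true  = x , px
  ... | false = length-filterᵇ-satisfied p xs h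

module _ {k : ℕ} where

  count-cong : ∀ {p q : Fin k → Bool} → (∀ v → p v ≡ q v) → count p ≡ count q
  count-cong p≗q = length-filterᵇ-cong p≗q (allFin k)

  count-none : ∀ {p : Fin k → Bool} → (∀ v → p v ≡ false) → count p ≡ 0
  count-none none = length-filterᵇ-none none (allFin k)

  count-∨-∧ : ∀ (p q : Fin k → Bool) →
    count (λ v → p v ∨ q v) + count (λ v → p v ∧ q v) ≡ count p + count q
  count-∨-∧ p q = length-filterᵇ-∨-∧ p q (allFin k)

  count-∨-disjoint : ∀ {p q : Fin k → Bool} → (∀ v → p v ∧ q v ≡ false) →
    count (λ v → p v ∨ q v) ≡ count p + count q
  count-∨-disjoint {p} {q} disjoint = begin
    count (λ v → p v ∨ q v)
      ≡⟨ +-identityʳ _ ⟨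
    count (λ v → p v ∨ q v) + 0
      ≡⟨ cong (count (λ v → p v ∨ q v) +_) (count-none disjoint) ⟨
    count (λ v → p v ∨ q v) + count (λ v → p v ∧ q v)
      ≡⟨ count-∨-∧ p q ⟩
    count p + count q ∎
    where open ≡-Reasoning

  count-not : ∀ (p : Fin k → Bool) → count p + count (not ∘ p) ≡ k
  count-not p = trans (length-filterᵇ-not p (allFin k)) (length-tabulate id)

  count≡suc⇒∃ : ∀ (p : Fin k → Bool) {m} → count p ≡ suc m → ∃ λ v → p v ≡ true
  count≡suc⇒∃ p = length-filterᵇ-satisfied p (allFin k)

  someᵇ⇒∃ : ∀ {p : Fin k → Bool} → someᵇ p ≡ true → ∃ λ v → p v ≡ true
  someᵇ⇒∃ {p} h =
    map₂ (Equivalence.to T-≡) (satisfied (any⁻ p (allFin k) (Equivalence.from T-≡ h)))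

  ∃⇒someᵇ : ∀ {p : Fin k → Bool} v → p v ≡ true → someᵇ p ≡ true
  ∃⇒someᵇ {p} v pv = Equivalence.to T-≡ (any⁺ p (lose (∈-allFin v) (Equivalence.from T-≡ pv)))

  someᵇ-cong : ∀ {p q : Fin k → Bool} → (∀ v → p v ≡ q v) → someᵇ p ≡ someᵇ q
  someᵇ-cong p≗q = cong or (map-cong p≗q (allFin k))

count-tail : ∀ {k} (p : Fin (suc k) → Bool) →
  length (filterᵇ p (tabulate suc)) ≡ count (p ∘ suc)
count-tail {k} p = begin
  length (filterᵇ p (tabulate suc))          ≡⟨ cong (length ∘ filterᵇ p) (map-tabulate id suc) ⟨
  length (filterᵇ p (map suc (allFin k)))    ≡⟨ length-filterᵇ-map p suc (allFin k) ⟩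
  count (p ∘ suc)                            ∎
  where open ≡-Reasoning

count-singleton : ∀ {k} (e : Fin k) → count (_=ᶠ e) ≡ 1
count-singleton {suc k} zero =
  cong suc (trans (count-tail {k} (_=ᶠ zero)) (count-none {k} {(_=ᶠ zero) ∘ suc} (λ _ → refl)))
count-singleton {suc k} (suc e) =
  trans (count-tail {k} (_=ᶠ suc e)) (trans (count-cong (λ v → =ᶠ-suc v e)) (count-singleton e))

pair-member : ∀ {k} {e f u : Fin k} → (u =ᶠ e) ∨ (u =ᶠ f) ≡ true → u ≡ e ⊎ u ≡ f
pair-member {e = e} {u = u} h with ∨-true {u =ᶠ e} h
... | inj₁ u=e = inj₁ (=ᶠ⇒≡ u=e)
... | inj₂ u=f = inj₂ (=ᶠ⇒≡ u=f)

count-pair : ∀ {k} {e f : Fin k} → ¬ e ≡ f → count (λ v → (v =ᶠ e) ∨ (v =ᶠ f)) ≡ 2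
count-pair {e = e} {f} e≢f =
  trans (count-∨-disjoint disjoint) (cong₂ _+_ (count-singleton e) (count-singleton f))
  where
  disjoint : ∀ v → (v =ᶠ e) ∧ (v =ᶠ f) ≡ false
  disjoint v = ¬-not λ h → let v=e , v=f = ∧-true {v =ᶠ e} h in
    e≢f (trans (sym (=ᶠ⇒≡ v=e)) (=ᶠ⇒≡ v=f))

not-∨ : ∀ a b → not (a ∨ b) ≡ not a ∧ not b
not-∨ true  b = refl
not-∨ false b = refl

count-partition : ∀ {k} {p q : Fin k → Bool} → (∀ v → p v ∧ q v ≡ false) →
  count p + count q + count (λ v → not (p v) ∧ not (q v)) ≡ k
count-partition {k} {p} {q} disjoint = begin
  count p + count q + count (λ v → not (p v) ∧ not (q v))
    ≡⟨ cong₂ _+_ (count-∨-disjoint disjoint) (count-cong (λ v → not-∨ (p v) (q v))) ⟨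
  count (λ v → p v ∨ q v) + count (λ v → not (p v ∨ q v))
    ≡⟨ count-not (λ v → p v ∨ q v) ⟩
  k ∎
  where open ≡-Reasoning

_─_ : ∀ {k} → (Fin k → Bool) → Fin k → Fin k → Bool
(I ─ e) v = I v ∧ not (v =ᶠ e)

module _ {k : ℕ} {I : Fin k → Bool} {e : Fin k} where

  ─-member : ∀ {v} → (I ─ e) v ≡ true → I v ≡ true × ¬ v ≡ e
  ─-member {v} h with ∧-true {I v} h
  ... | Iv , ¬v=e = Iv , λ v≡e → case trans (sym ¬v=e) (cong not (≡⇒=ᶠ v≡e)) of λ ()

  ─-restore : I e ≡ true → ∀ v → I v ≡ (v =ᶠ e) ∨ (I ─ e) v
  ─-restore Ie v with v ≟ e
  ... | yes refl = Ie
  ... | no  _    = sym (∧-identityʳ (I v))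

  count-─ : I e ≡ true → count I ≡ suc (count (I ─ e))
  count-─ Ie = begin
    count I                                     ≡⟨ count-cong (─-restore Ie) ⟩
    count (λ v → (v =ᶠ e) ∨ (I ─ e) v)          ≡⟨ count-∨-disjoint disjoint ⟩
    count (_=ᶠ e) + count (I ─ e)               ≡⟨ cong (_+ count (I ─ e)) (count-singleton e) ⟩
    suc (count (I ─ e))                         ∎
    where
    open ≡-Reasoning
    disjoint : ∀ v → (v =ᶠ e) ∧ (I ─ e) v ≡ false
    disjoint v with v =ᶠ e
    ... | true  = ∧-zeroʳ (I v)
    ... | false = refl

m+n≡o⇒m≡o∸n : ∀ {m n o} → m + n ≡ o → m ≡ o ∸ n
m+n≡o⇒m≡o∸n {m} {n} eq = trans (sym (m+n∸n≡m m n)) (cong (_∸ n) eq)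

m+n≡o⇒n≡o∸m : ∀ {m n o} → m + n ≡ o → n ≡ o ∸ m
m+n≡o⇒n≡o∸m {m} {n} eq = trans (sym (m+n∸m≡n m n)) (cong (_∸ m) eq)

[1+n]C2≡n+nC2 : ∀ n → suc n C 2 ≡ n + n C 2
[1+n]C2≡n+nC2 n = trans (sym (nCk+nC[k+1]≡[n+1]C[k+1] n 1)) (cong (_+ n C 2) (nC1≡n n))

module _ (H : FinGraph) where

  private
    N = size H
    V = Fin N
    adj = adjH H

  Nonadjacent : V → V → Set
  Nonadjacent u v = ¬ u ≡ v × adj u v ≡ false

  Regular : Set
  Regular = Σ ℕ λ k → ∀ v → count (adj v) ≡ k

  CoEdgeRegular : Set
  CoEdgeRegular = Σ ℕ λ c → ∀ u v → Nonadjacent u v → count (λ w → adj w u ∧ adj w v) ≡ c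

  ClawFree : Set
  ClawFree = ∀ {w u v x} → adj w u ≡ true → adj w v ≡ true → adj w x ≡ true →
    Nonadjacent u v → Nonadjacent u x → Nonadjacent v x → ⊥

  nbrs : (V → Bool) → V → Bool
  nbrs I v = someᵇ (λ u → I u ∧ adj u v)

  nbrs-intro : ∀ {I u v} → I u ≡ true → adj u v ≡ true → nbrs I v ≡ true
  nbrs-intro {u = u} Iu u~v = ∃⇒someᵇ u (∧-intro Iu u~v)

  nbrs-elim : ∀ {I v} → nbrs I v ≡ true → ∃ λ u → I u ≡ true × adj u v ≡ true
  nbrs-elim h = map₂ ∧-true (someᵇ⇒∃ h)

  module _ {I J : V → Bool} {v : V} where

    nbrs-cong : (∀ u → I u ≡ J u) → nbrs I v ≡ nbrs J v
    nbrs-cong I≗J = someᵇ-cong (λ u → cong (_∧ adj u v) (I≗J u))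

    nbrs-∨ : nbrs (λ u → I u ∨ J u) v ≡ nbrs I v ∨ nbrs J v
    nbrs-∨ = Bool-ext to from
      where
      to : nbrs (λ u → I u ∨ J u) v ≡ true → nbrs I v ∨ nbrs J v ≡ true
      to h with nbrs-elim h
      ... | u , I∨Ju , u~v with ∨-true {I u} I∨Ju
      ...   | inj₁ Iu = ∨-introˡ _ (nbrs-intro Iu u~v)
      ...   | inj₂ Ju = ∨-introʳ _ (nbrs-intro Ju u~v)
      from : nbrs I v ∨ nbrs J v ≡ true → nbrs (λ u → I u ∨ J u) v ≡ true
      from h with ∨-true {nbrs I v} h
      ... | inj₁ hI = let u , Iu , u~v = nbrs-elim hI in nbrs-intro (∨-introˡ (J u) Iu) u~v
      ... | inj₂ hJ = let u , Ju , u~v = nbrs-elim hJ in nbrs-intro (∨-introʳ (I u) Ju) u~v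

  nbrs-singleton : ∀ e v → nbrs (_=ᶠ e) v ≡ adj e v
  nbrs-singleton e v = Bool-ext
    (λ h → let u , u=e , u~v = nbrs-elim h in subst (λ x → adj x v ≡ true) (=ᶠ⇒≡ u=e) u~v)
    (nbrs-intro (≡⇒=ᶠ refl))

  nbrs-pair : ∀ e f v → nbrs (λ u → (u =ᶠ e) ∨ (u =ᶠ f)) v ≡ adj e v ∨ adj f v
  nbrs-pair e f v = trans nbrs-∨ (cong₂ _∨_ (nbrs-singleton e v) (nbrs-singleton f v))

  nbrs-─ : ∀ {I e} → I e ≡ true → ∀ v → nbrs I v ≡ adj e v ∨ nbrs (I ─ e) v
  nbrs-─ {I} {e} Ie v = begin
    nbrs I v                              ≡⟨ nbrs-cong (─-restore Ie) ⟩
    nbrs (λ u → (u =ᶠ e) ∨ (I ─ e) u) v   ≡⟨ nbrs-∨ ⟩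
    nbrs (_=ᶠ e) v ∨ nbrs (I ─ e) v       ≡⟨ cong (_∨ nbrs (I ─ e) v) (nbrs-singleton e v) ⟩
    adj e v ∨ nbrs (I ─ e) v              ∎
    where open ≡-Reasoning

  nbrs-empty : ∀ {I} → count I ≡ 0 → ∀ v → nbrs I v ≡ false
  nbrs-empty {I} #I≡0 v = ¬-not λ h → let u , Iu , _ = nbrs-elim h in
    case trans (sym #I≡0) (count-─ {I = I} Iu) of λ ()

  independent-─ : ∀ {I e} → IndependentSet H I → IndependentSet H (I ─ e)
  independent-─ {I} {e} indI u v hu hv =
    indI u v (proj₁ (─-member {I = I} {e} hu)) (proj₁ (─-member {I = I} {e} hv))

  independent-singleton : (∀ v → adj v v ≡ false) → ∀ e → IndependentSet H (_=ᶠ e)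
  independent-singleton adj-irrefl e u v u=e v=e =
    trans (cong₂ adj (=ᶠ⇒≡ u=e) (=ᶠ⇒≡ v=e)) (adj-irrefl e)

  independent-pair : (∀ v → adj v v ≡ false) → (∀ u v → adj u v ≡ adj v u) →
    ∀ {e f} → Nonadjacent e f → IndependentSet H (λ u → (u =ᶠ e) ∨ (u =ᶠ f))
  independent-pair adj-irrefl adj-sym {e} {f} (_ , e≁f) u v Iu Iv
    with pair-member {u = u} Iu | pair-member {u = v} Iv
  ... | inj₁ refl | inj₁ refl = adj-irrefl u
  ... | inj₁ refl | inj₂ refl = e≁f
  ... | inj₂ refl | inj₁ refl = trans (adj-sym f e) e≁f
  ... | inj₂ refl | inj₂ refl = adj-irrefl u

  independent-partition : ∀ {I} → IndependentSet H I →
    count I + count (nbrs I) + nonNbrs H I ≡ N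
  independent-partition {I} indI = count-partition disjoint
    where
    disjoint : ∀ v → I v ∧ nbrs I v ≡ false
    disjoint v with I v in Iv
    ... | false = refl
    ... | true  = ¬-not λ h → let u , Iu , u~v = nbrs-elim h in
      case trans (sym u~v) (indI u v Iu Iv) of λ ()

  fullyRegular⇒regular : (∀ v → adj v v ≡ false) → (∀ u v → adj u v ≡ adj v u) →
    FullyRegular H → Regular × CoEdgeRegular
  fullyRegular⇒regular adj-irrefl adj-sym (a , fullyRegular) = (k , degree) , (c , common)
    where
    open ≡-Reasoning

    count+count-nbrs : ∀ {I} → IndependentSet H I → count I + count (nbrs I) ≡ N ∸ a (count I)
    count+count-nbrs {I} indI = m+n≡o⇒m≡o∸n (begin
      count I + count (nbrs I) + a (count I)  ≡⟨ cong (_ +_) (fullyRegular I indI) ⟨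
      count I + count (nbrs I) + nonNbrs H I  ≡⟨ independent-partition indI ⟩
      N                                       ∎)

    k : ℕ
    k = N ∸ a 1 ∸ 1

    degree : ∀ e → count (adj e) ≡ k
    degree e = m+n≡o⇒n≡o∸m (begin
      1 + count (adj e)
        ≡⟨ cong₂ _+_ (count-singleton e) (count-cong (nbrs-singleton e)) ⟨
      count (_=ᶠ e) + count (nbrs (_=ᶠ e))
        ≡⟨ count+count-nbrs (independent-singleton adj-irrefl e) ⟩
      N ∸ a (count (_=ᶠ e))
        ≡⟨ cong (λ m → N ∸ a m) (count-singleton e) ⟩
      N ∸ a 1 ∎)

    c : ℕ
    c = (k + k) ∸ (N ∸ a 2 ∸ 2)

    common : ∀ e f → Nonadjacent e f → count (λ w → adj w e ∧ adj w f) ≡ c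
    common e f e≁f = begin
      count (λ w → adj w e ∧ adj w f)
        ≡⟨ count-cong (λ w → cong₂ _∧_ (adj-sym w e) (adj-sym w f)) ⟩
      count (λ w → adj e w ∧ adj f w)
        ≡⟨ m+n≡o⇒n≡o∸m (trans (count-∨-∧ (adj e) (adj f)) (cong₂ _+_ (degree e) (degree f))) ⟩
      (k + k) ∸ count (λ w → adj e w ∨ adj f w)
        ≡⟨ cong ((k + k) ∸_) (m+n≡o⇒n≡o∸m {2} count-pair+count-nbrs) ⟩
      c ∎
      where
      I : V → Bool
      I u = (u =ᶠ e) ∨ (u =ᶠ f)
      count-pair+count-nbrs : 2 + count (λ w → adj e w ∨ adj f w) ≡ N ∸ a 2
      count-pair+count-nbrs = begin
        2 + count (λ w → adj e w ∨ adj f w)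
          ≡⟨ cong₂ _+_ (count-pair (proj₁ e≁f)) (count-cong (nbrs-pair e f)) ⟨
        count I + count (nbrs I)
          ≡⟨ count+count-nbrs (independent-pair adj-irrefl adj-sym e≁f) ⟩
        N ∸ a (count I)
          ≡⟨ cong (λ m → N ∸ a m) (count-pair (proj₁ e≁f)) ⟩
        N ∸ a 2 ∎

  module NeighbourhoodCounting (adj-sym : ∀ u v → adj u v ≡ adj v u) (claw-free : ClawFree)
    (k : ℕ) (degree : ∀ v → count (adj v) ≡ k)
    (c : ℕ) (common : ∀ u v → Nonadjacent u v → count (λ w → adj w u ∧ adj w v) ≡ c) where

    count-adj∧nbrs : ∀ m {e J} → count J ≡ m → IndependentSet H J →
      (∀ u → J u ≡ true → Nonadjacent e u) → count (λ v → adj e v ∧ nbrs J v) ≡ m * c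
    count-adj∧nbrs zero {e} {J} #J≡0 _ _ =
      count-none λ v → trans (cong (adj e v ∧_) (nbrs-empty #J≡0 v)) (∧-zeroʳ (adj e v))
    count-adj∧nbrs (suc m) {e} {J} #J≡1+m indJ e≁J with count≡suc⇒∃ J #J≡1+m
    ... | u , Ju = begin
      count (λ v → adj e v ∧ nbrs J v)
        ≡⟨ count-cong (λ v → trans (cong (adj e v ∧_) (nbrs-─ Ju v)) (∧-distribˡ-∨ (adj e v) _ _)) ⟩
      count (λ v → P v ∨ Q v)   ≡⟨ count-∨-disjoint disjoint ⟩
      count P + count Q         ≡⟨ cong₂ _+_ count-P count-Q ⟩
      c + m * c                 ∎
      where
      open ≡-Reasoning
      P Q : V → Bool
      P v = adj e v ∧ adj u v
      Q v = adj e v ∧ nbrs (J ─ u) v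
      count-P : count P ≡ c
      count-P = trans (count-cong (λ v → cong₂ _∧_ (adj-sym e v) (adj-sym u v)))
                      (common e u (e≁J u Ju))
      count-Q : count Q ≡ m * c
      count-Q = count-adj∧nbrs m (suc-injective (trans (sym (count-─ {I = J} Ju)) #J≡1+m))
        (independent-─ indJ) (λ w J─uw → e≁J w (proj₁ (─-member {I = J} {u} J─uw)))
      -- A common neighbour v of e, u and some other w ∈ J would be the centre of a claw.
      disjoint : ∀ v → P v ∧ Q v ≡ false
      disjoint v = ¬-not λ h →
        let Pv , Qv = ∧-true {P v} h
            e~v , u~v = ∧-true {adj e v} Pv
            w , J─uw , w~v = nbrs-elim (proj₂ (∧-true {adj e v} Qv))
            Jw , w≢u = ─-member {I = J} {u} J─uw
        in claw-free (trans (adj-sym v e) e~v) (trans (adj-sym v u) u~v) (trans (adj-sym v w) w~v)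
             (e≁J u Ju) (e≁J w Jw) ((λ u≡w → w≢u (sym u≡w)) , indJ u w Ju Jw)

    count-nbrs : ∀ m {I} → count I ≡ m → IndependentSet H I →
      count (nbrs I) + (m C 2) * c ≡ m * k
    count-nbrs zero {I} #I≡0 _ = trans (+-identityʳ _) (count-none (nbrs-empty #I≡0))
    count-nbrs (suc m) {I} #I≡1+m indI with count≡suc⇒∃ I #I≡1+m
    ... | e , Ie = begin
      X + (suc m C 2) * c          ≡⟨ cong (λ t → X + t * c) ([1+n]C2≡n+nC2 m) ⟩
      X + (m + m C 2) * c          ≡⟨ cong (X +_) (*-distribʳ-+ c m (m C 2)) ⟩
      X + (m * c + (m C 2) * c)    ≡⟨ +-assoc X (m * c) _ ⟨
      X + m * c + (m C 2) * c      ≡⟨ cong (_+ (m C 2) * c) remove-e ⟩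
      Y + k + (m C 2) * c          ≡⟨ trans (cong (_+ (m C 2) * c) (+-comm Y k)) (+-assoc k Y _) ⟩
      k + (Y + (m C 2) * c)        ≡⟨ cong (k +_) (count-nbrs m #I─e indI─e) ⟩
      k + m * k                    ∎
      where
      open ≡-Reasoning
      X Y : ℕ
      X = count (nbrs I)
      Y = count (nbrs (I ─ e))
      #I─e : count (I ─ e) ≡ m
      #I─e = suc-injective (trans (sym (count-─ {I = I} Ie)) #I≡1+m)
      indI─e : IndependentSet H (I ─ e)
      indI─e = independent-─ indI
      e≁I─e : ∀ w → (I ─ e) w ≡ true → Nonadjacent e w
      e≁I─e w I─ew = let Iw , w≢e = ─-member {I = I} {e} I─ew in
        (λ e≡w → w≢e (sym e≡w)) , indI e w Ie Iw
      remove-e : X + m * c ≡ Y + k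
      remove-e = begin
        X + m * c
          ≡⟨ cong₂ _+_ (sym (count-cong (nbrs-─ Ie))) (count-adj∧nbrs m #I─e indI─e e≁I─e) ⟨
        count (λ v → adj e v ∨ nbrs (I ─ e) v) + count (λ v → adj e v ∧ nbrs (I ─ e) v)
          ≡⟨ count-∨-∧ (adj e) (nbrs (I ─ e)) ⟩
        count (adj e) + Y  ≡⟨ trans (cong (_+ Y) (degree e)) (+-comm k Y) ⟩
        Y + k              ∎

  clawFree⇒fullyRegular : (∀ u v → adj u v ≡ adj v u) → ClawFree →
    Regular → CoEdgeRegular → FullyRegular H
  clawFree⇒fullyRegular adj-sym claw-free (k , degree) (c , common) = a , nonNbrs≡a
    where
    open NeighbourhoodCounting adj-sym claw-free k degree c common
    a : ℕ → ℕ
    a m = N ∸ (m + (m * k ∸ (m C 2) * c))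
    nonNbrs≡a : ∀ I → IndependentSet H I → nonNbrs H I ≡ a (count I)
    nonNbrs≡a I indI = begin
      nonNbrs H I
        ≡⟨ m+n≡o⇒n≡o∸m (independent-partition indI) ⟩
      N ∸ (count I + count (nbrs I))
        ≡⟨ cong (λ x → N ∸ (count I + x)) (m+n≡o⇒m≡o∸n (count-nbrs _ refl indI)) ⟩
      a (count I) ∎
      where open ≡-Reasoning

_∈ₑ_ : ∀ {k} → Fin k → Fin k × Fin k → Set
x ∈ₑ (c , d) = x ≡ c ⊎ x ≡ d

module _ {k : ℕ} where

  shareVertex-intro : ∀ {x : Fin k} p q → x ∈ₑ p → x ∈ₑ q → shareVertex p q ≡ true
  shareVertex-intro {x} (a , b) (c , d) (inj₁ refl) (inj₁ refl) =
    ∨-introˡ {x =ᶠ x} ((x =ᶠ d) ∨ (b =ᶠ x) ∨ (b =ᶠ d)) (≡⇒=ᶠ refl)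
  shareVertex-intro {x} (a , b) (c , d) (inj₁ refl) (inj₂ refl) =
    ∨-introʳ (x =ᶠ c) (∨-introˡ {x =ᶠ x} ((b =ᶠ c) ∨ (b =ᶠ x)) (≡⇒=ᶠ refl))
  shareVertex-intro {x} (a , b) (c , d) (inj₂ refl) (inj₁ refl) =
    ∨-introʳ (a =ᶠ x) (∨-introʳ (a =ᶠ d) (∨-introˡ {x =ᶠ x} (x =ᶠ d) (≡⇒=ᶠ refl)))
  shareVertex-intro {x} (a , b) (c , d) (inj₂ refl) (inj₂ refl) =
    ∨-introʳ (a =ᶠ c) (∨-introʳ (a =ᶠ x) (∨-introʳ (x =ᶠ c) (≡⇒=ᶠ refl)))

  shareVertex-common : ∀ {x : Fin k} p q → x ∈ₑ p → x ∈ₑ q → ¬ shareVertex p q ≡ false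
  shareVertex-common p q x∈p x∈q p∩q=∅ =
    case trans (sym (shareVertex-intro p q x∈p x∈q)) p∩q=∅ of λ ()

  shareVertex-elim : ∀ (a b : Fin k) q → shareVertex (a , b) q ≡ true → a ∈ₑ q ⊎ b ∈ₑ q
  shareVertex-elim a b (c , d) h with ∨-true {a =ᶠ c} h
  ... | inj₁ a=c = inj₁ (inj₁ (=ᶠ⇒≡ a=c))
  ... | inj₂ h₁ with ∨-true {a =ᶠ d} h₁
  ...   | inj₁ a=d = inj₁ (inj₂ (=ᶠ⇒≡ a=d))
  ...   | inj₂ h₂ with ∨-true {b =ᶠ c} h₂
  ...     | inj₁ b=c = inj₂ (inj₁ (=ᶠ⇒≡ b=c))
  ...     | inj₂ b=d = inj₂ (inj₂ (=ᶠ⇒≡ b=d))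

  shareVertex-flip : ∀ p q → shareVertex p q ≡ true → shareVertex q p ≡ true
  shareVertex-flip (a , b) q h with shareVertex-elim a b q h
  ... | inj₁ a∈q = shareVertex-intro q (a , b) a∈q (inj₁ refl)
  ... | inj₂ b∈q = shareVertex-intro q (a , b) b∈q (inj₂ refl)

  shareVertex-sym : ∀ p q → shareVertex p q ≡ shareVertex q p
  shareVertex-sym p q = Bool-ext (shareVertex-flip p q) (shareVertex-flip q p)

  shareVertex-pigeonhole : ∀ g p q r →
    shareVertex g p ≡ true → shareVertex g q ≡ true → shareVertex g r ≡ true →
    shareVertex p q ≡ false → shareVertex p r ≡ false → shareVertex q r ≡ false → ⊥
  shareVertex-pigeonhole (a , b) p q r gp gq gr pq pr qr
    with shareVertex-elim a b p gp | shareVertex-elim a b q gq | shareVertex-elim a b r gr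
  ... | inj₁ a∈p | inj₁ a∈q | _        = shareVertex-common p q a∈p a∈q pq
  ... | inj₂ b∈p | inj₂ b∈q | _        = shareVertex-common p q b∈p b∈q pq
  ... | inj₁ a∈p | inj₂ _   | inj₁ a∈r = shareVertex-common p r a∈p a∈r pr
  ... | inj₂ b∈p | inj₁ _   | inj₂ b∈r = shareVertex-common p r b∈p b∈r pr
  ... | inj₁ _   | inj₂ b∈q | inj₂ b∈r = shareVertex-common q r b∈q b∈r qr
  ... | inj₂ _   | inj₁ a∈q | inj₁ a∈r = shareVertex-common q r a∈q a∈r qr

module _ (G : Graph) {e f : Edge G} where

  edgeAdj-≢ : ¬ e ≡ f → edgeAdj G e f ≡ shareVertex (ends G e) (ends G f)
  edgeAdj-≢ e≢f = cong (λ b → not b ∧ shareVertex (ends G e) (ends G f)) (≢⇒=ᶠ e≢f)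

  edgeAdj⇒shareVertex : edgeAdj G e f ≡ true → shareVertex (ends G e) (ends G f) ≡ true
  edgeAdj⇒shareVertex h = proj₂ (∧-true {not (e =ᶠ f)} h)

  nonadjacent⇒independent : Nonadjacent (LineGraph G) e f → EdgeIndependent G e f
  nonadjacent⇒independent (e≢f , e≁f) = e≢f , trans (sym (edgeAdj-≢ e≢f)) e≁f

  independent⇒nonadjacent : EdgeIndependent G e f → Nonadjacent (LineGraph G) e f
  independent⇒nonadjacent (e≢f , e∩f=∅) = e≢f , trans (edgeAdj-≢ e≢f) e∩f=∅

module _ (G : Graph) where

  edgeAdj-sym : ∀ e f → edgeAdj G e f ≡ edgeAdj G f e
  edgeAdj-sym e f = cong₂ (λ b s → not b ∧ s) (=ᶠ-sym e f) (shareVertex-sym (ends G e) (ends G f))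

  edgeAdj-irrefl : ∀ e → edgeAdj G e e ≡ false
  edgeAdj-irrefl e = cong (λ b → not b ∧ shareVertex (ends G e) (ends G e)) (≡⇒=ᶠ refl)

  lineGraph-clawFree : ClawFree (LineGraph G)
  lineGraph-clawFree {g} g~e g~f g~h e≁f e≁h f≁h = shareVertex-pigeonhole (ends G g) _ _ _
    (edgeAdj⇒shareVertex G g~e) (edgeAdj⇒shareVertex G g~f) (edgeAdj⇒shareVertex G g~h)
    (proj₂ (nonadjacent⇒independent G e≁f)) (proj₂ (nonadjacent⇒independent G e≁h))
    (proj₂ (nonadjacent⇒independent G f≁h))

lemma5 : (G : Graph) →
    (FullyRegular (LineGraph G) → EdgeRegular G × IndepPairsRegular G) ×
    (EdgeRegular G × IndepPairsRegular G → FullyRegular (LineGraph G))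
lemma5 G = fullyRegular⇒ , ⇒fullyRegular
  where
  fullyRegular⇒ : FullyRegular (LineGraph G) → EdgeRegular G × IndepPairsRegular G
  fullyRegular⇒ fr =
    let regular , (c , common) = fullyRegular⇒regular (LineGraph G) (edgeAdj-irrefl G) (edgeAdj-sym G) fr
    in regular , (c , λ e f e∩f=∅ → common e f (independent⇒nonadjacent G e∩f=∅))

  ⇒fullyRegular : EdgeRegular G × IndepPairsRegular G → FullyRegular (LineGraph G)
  ⇒fullyRegular (regular , (c , common)) =
    clawFree⇒fullyRegular (LineGraph G) (edgeAdj-sym G) (lineGraph-clawFree G) regular
      (c , λ e f e≁f → common e f (nonadjacent⇒independent G e≁f))
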